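{- Let $\pi\in\mathfrak{S}_n$ with rix-factorization $\pi=\alpha_1\cdots\alpha_k\beta$. The following are equivalent: (a) $\beta$ is increasing; (b) every letter of $\beta$ is a rixed point of $\pi$; (c) every letter of $\beta$ is either a rixed point of $\pi$ or equal to $\beta_1(\pi)$; (d) $\beta_1(\pi)$ is a rixed point of $\pi$. Furthermore, if $y$ is a letter of $\beta$ that is neither $\beta_1(\pi)$ nor a rixed point of $\pi$, then $y<\beta_1(\pi)$.
   Context: Rix-factorization of $\pi\in\mathfrak{S}_n$ (one-line notation): $\pi=\alpha_1\cdots\alpha_k\beta$ obtained by (1) $w:=\pi$, $i:=0$; (2) if $w$ increasing, $\beta:=w$, stop; else $i:=i+1$, let $x$ be the largest descent of the word $w$ (letter larger than its right neighbour in $w$), write $w=w'xw''$; (3) if $w'$ empty, $\beta:=w$, stop; else $\alpha_i:=w'x$, $w:=w''$, go to (2). $\beta_1(\pi)$ is the first letter of $\beta$. A rixed point of $\pi$ is a letter of the maximal increasing suffix of $\pi$ not smaller than $\beta_1(\pi)$. -}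

module Defs where

open import Data.Nat using (ℕ; zero; suc; _<_; _≤_; _⊔_; _<?_)
open import Data.Nat.Properties using (_≟_)
open import Data.List using (List; []; _∷_; length; foldr)
open import Data.List.Relation.Unary.Linked using (Linked; linked?)
open import Data.List.Membership.Propositional using (_∈_)
open import Data.Product using (_×_; _,_)
open import Relation.Nullary using (yes; no)

Increasing : List ℕ → Set
Increasing = Linked _<_

increasing? : (w : List ℕ) → _
increasing? = linked? _<?_

descents : List ℕ → List ℕ
descents [] = []
descents (x ∷ []) = []
descents (x ∷ (y ∷ ys)) = cons? (descents (y ∷ ys))
  where
  cons? : List ℕ → List ℕ
  cons? r with y <? x
  ... | yes _ = x ∷ r
  ... | no _  = r

maxList : List ℕ → ℕ
maxList = foldr _⊔_ 0

-- The largest descent of a word (only meaningful if the word is not increasing).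
largestDescent : List ℕ → ℕ
largestDescent w = maxList (descents w)

splitOn : ℕ → List ℕ → List ℕ × List ℕ
splitOn x [] = [] , []
splitOn x (y ∷ ys) with y ≟ x
... | yes _ = [] , ys
... | no _ with splitOn x ys
...   | a , b = (y ∷ a) , b

-- The rix-factorization loop, with fuel (each iteration strictly shortens w,
-- so fuel = length w is sufficient).
rixLoop : ℕ → List ℕ → List ℕ
rixLoop zero w = w
rixLoop (suc f) w with increasing? w
... | yes _ = w
... | no _ with splitOn (largestDescent w) w
...   | [] , _ = w
...   | (_ ∷ _) , w'' = rixLoop f w''

rixBeta : List ℕ → List ℕ
rixBeta π = rixLoop (length π) π

headOr : ℕ → List ℕ → ℕ
headOr d [] = d
headOr d (x ∷ _) = x

-- β₁(π): the first letter of β (β is nonempty whenever π is).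
beta1 : List ℕ → ℕ
beta1 π = headOr 0 (rixBeta π)

maxIncSuffix : List ℕ → List ℕ
maxIncSuffix [] = []
maxIncSuffix (x ∷ xs) with increasing? (x ∷ xs)
... | yes _ = x ∷ xs
... | no _  = maxIncSuffix xs

IsRixed : List ℕ → ℕ → Set
IsRixed π y = (y ∈ maxIncSuffix π) × (beta1 π ≤ y)

-- The rix loop stops either because the remaining word β = x r is increasing, or because its
-- first letter x is its largest descent.  In the first case β lies in the maximal increasing
-- suffix of π and x is its least letter, so (a)–(d) all hold.  In the second case the letters
-- being distinct forces the letter after x to be smaller than x, which refutes (c), and x lies
-- outside the maximal increasing suffix, which refutes (d); so (a)–(d) all fail.  The final
-- claim holds because a letter outside the maximal increasing suffix of a word of distinct
-- letters is at most some descent, hence at most the largest descent x.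
module Submission where

open import Defs
open import Data.Nat
open import Data.Nat.Properties
open import Data.List using (List; []; _∷_; _++_; length; applyUpTo)
open import Data.List.Properties using (++-assoc; ∷-injectiveˡ; length-++-≤ʳ; length-applyUpTo; foldr-preservesᵒ)
open import Data.List.Relation.Unary.Linked using ([]; [-]; _∷_)
import Data.List.Relation.Unary.Linked as Linked
open import Data.List.Relation.Unary.Linked.Properties using (Linked⇒AllPairs)
open import Data.List.Relation.Unary.AllPairs using (_∷_)
import Data.List.Relation.Unary.AllPairs as AllPairs
import Data.List.Relation.Unary.All as All
import Data.List.Relation.Unary.Any as Any
open import Data.List.Relation.Unary.Any using (here; there)
open import Data.List.Relation.Unary.Unique.Propositional using (Unique)
open import Data.List.Relation.Unary.Unique.Propositional.Properties using (Unique[x∷xs]⇒x∉xs; applyUpTo⁺₁)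
open import Data.List.Membership.Propositional using (_∈_; _∉_)
open import Data.List.Membership.Propositional.Properties using (∈-++⁺ʳ; foldr-selective)
open import Data.List.Relation.Binary.Permutation.Propositional using (_↭_; ↭⇒↭ₛ; ↭-sym)
open import Data.List.Relation.Binary.Permutation.Propositional.Properties using (↭-length)
open import Data.Product using (_×_; _,_; proj₁; proj₂; ∃-syntax)
open import Data.Sum using (_⊎_; inj₁; inj₂; [_,_])
open import Data.Empty using (⊥-elim)
open import Function using (_∘_; const)
open import Function.Bundles using (_⇔_; mk⇔)
open import Relation.Nullary using (¬_; yes; no)
open import Relation.Binary using (tri<; tri≈; tri>)
open import Relation.Binary.PropositionalEquality using (_≡_; _≢_; refl; sym; trans; cong; subst; setoid)
open import Data.List.Relation.Binary.Permutation.Setoid.Properties (setoid ℕ) using (Unique-resp-↭)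

private variable
  a b x y d z : ℕ
  p r w s ds : List ℕ

Increasing-++⁻ʳ : ∀ p → Increasing (p ++ s) → Increasing s
Increasing-++⁻ʳ []      inc = inc
Increasing-++⁻ʳ (_ ∷ p) inc = Increasing-++⁻ʳ p (Linked.tail inc)

Unique-++⁻ʳ : ∀ p → Unique (p ++ s) → Unique s
Unique-++⁻ʳ []      u = u
Unique-++⁻ʳ (_ ∷ p) u = Unique-++⁻ʳ p (AllPairs.tail u)

head≤ : Increasing (x ∷ r) → y ∈ x ∷ r → x ≤ y
head≤ inc (here refl) = ≤-refl
head≤ inc (there y∈r) with x<r ∷ _ ← Linked⇒AllPairs <-trans inc = <⇒≤ (All.lookup x<r y∈r)

≤maxList : d ∈ ds → d ≤ maxList ds
≤maxList {ds = ds} d∈ds =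
  foldr-preservesᵒ (λ m n → [ m≤n⇒m≤n⊔o n , m≤n⇒m≤o⊔n m ]) 0 ds (inj₂ (Any.map ≤-reflexive d∈ds))

maxList-∈ : d ∈ ds → maxList ds ∈ ds
maxList-∈ {ds = ds} d∈ds with foldr-selective ⊔-sel 0 ds
... | inj₂ max∈ds = max∈ds
... | inj₁ max≡0  = subst (_∈ ds) (trans (n≤0⇒n≡0 (subst (_ ≤_) max≡0 (≤maxList d∈ds))) (sym max≡0)) d∈ds

∈-descents-∷∷⁻ : ∀ a b w → d ∈ descents (a ∷ b ∷ w) → (b < a × d ≡ a) ⊎ d ∈ descents (b ∷ w)
∈-descents-∷∷⁻ a b w d∈ with b <? a
... | no _ = inj₂ d∈
... | yes b<a with d∈
...   | here d≡a   = inj₁ (b<a , d≡a)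
...   | there d∈′ = inj₂ d∈′

∈-descents-∷⁺ : ∀ a w → d ∈ descents w → d ∈ descents (a ∷ w)
∈-descents-∷⁺ a (b ∷ _) d∈ with b <? a
... | yes _ = there d∈
... | no _  = d∈

head∈descents : b < a → a ∈ descents (a ∷ b ∷ w)
head∈descents {b = b} {a = a} b<a with b <? a
... | yes _   = here refl
... | no b≮a = ⊥-elim (b≮a b<a)

∈-descents⇒∈ : ∀ w → d ∈ descents w → d ∈ w
∈-descents⇒∈ (a ∷ b ∷ w) d∈ =
  [ here ∘ proj₂ , there ∘ ∈-descents⇒∈ (b ∷ w) ] (∈-descents-∷∷⁻ a b w d∈)

descent-head⁻ : Unique (a ∷ b ∷ w) → a ∈ descents (a ∷ b ∷ w) → b < a
descent-head⁻ {a = a} {b = b} {w = w} u a∈ with ∈-descents-∷∷⁻ a b w a∈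
... | inj₁ (b<a , _) = b<a
... | inj₂ a∈′       = ⊥-elim (Unique[x∷xs]⇒x∉xs u (∈-descents⇒∈ (b ∷ w) a∈′))

maxIncSuffix-⊆ : ∀ w → y ∈ maxIncSuffix w → y ∈ w
maxIncSuffix-⊆ (x ∷ w) y∈ with increasing? (x ∷ w)
... | yes _ = y∈
... | no _  = there (maxIncSuffix-⊆ w y∈)

maxIncSuffix-++ : ∀ p → ¬ Increasing s → maxIncSuffix (p ++ s) ≡ maxIncSuffix s
maxIncSuffix-++ []      ¬inc = refl
maxIncSuffix-++ {s = s} (x ∷ p) ¬inc with increasing? (x ∷ p ++ s)
... | yes inc = ⊥-elim (¬inc (Increasing-++⁻ʳ (x ∷ p) inc))
... | no _    = maxIncSuffix-++ p ¬inc

∈-maxIncSuffix-++ : ∀ p → Increasing s → y ∈ s → y ∈ maxIncSuffix (p ++ s)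
∈-maxIncSuffix-++ {s = x ∷ s} [] inc y∈ with increasing? (x ∷ s)
... | yes _    = y∈
... | no ¬inc = ⊥-elim (¬inc inc)
∈-maxIncSuffix-++ {s = s} (x ∷ p) inc y∈ with increasing? (x ∷ p ++ s)
... | yes _ = there (∈-++⁺ʳ p y∈)
... | no _  = ∈-maxIncSuffix-++ p inc y∈

head∉maxIncSuffix : Unique (x ∷ w) → ¬ Increasing (x ∷ w) → x ∉ maxIncSuffix (x ∷ w)
head∉maxIncSuffix {x} {w} u ¬inc x∈ with increasing? (x ∷ w)
... | yes inc = ¬inc inc
... | no _    = Unique[x∷xs]⇒x∉xs u (maxIncSuffix-⊆ w x∈)

descent≥head : Unique (a ∷ w) → ¬ Increasing (a ∷ w) → ∃[ d ] d ∈ descents (a ∷ w) × a ≤ d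
descent≥head {w = []}    _ ¬inc = ⊥-elim (¬inc [-])
descent≥head {a} {b ∷ w} u ¬inc with <-cmp b a
... | tri< b<a _ _ = a , head∈descents {w = w} b<a , ≤-refl
... | tri≈ _ b≡a _ = ⊥-elim (Unique[x∷xs]⇒x∉xs u (here (sym b≡a)))
... | tri> _ _ a<b =
  let d , d∈ , b≤d = descent≥head (AllPairs.tail u) (¬inc ∘ (a<b ∷_))
  in  d , ∈-descents-∷⁺ a (b ∷ w) d∈ , ≤-trans (<⇒≤ a<b) b≤d

∉maxIncSuffix⇒≤descent : Unique w → y ∈ w → y ∉ maxIncSuffix w → ∃[ d ] d ∈ descents w × y ≤ d
∉maxIncSuffix⇒≤descent {a ∷ w} u y∈ y∉ with increasing? (a ∷ w)
... | yes _    = ⊥-elim (y∉ y∈)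
... | no ¬inc with y∈
...   | here refl = descent≥head u ¬inc
...   | there y∈w =
  let d , d∈ , y≤d = ∉maxIncSuffix⇒≤descent (AllPairs.tail u) y∈w y∉
  in  d , ∈-descents-∷⁺ a w d∈ , y≤d

∉maxIncSuffix⇒≤largestDescent : Unique w → y ∈ w → y ∉ maxIncSuffix w → y ≤ largestDescent w
∉maxIncSuffix⇒≤largestDescent u y∈ y∉ =
  let _ , d∈ , y≤d = ∉maxIncSuffix⇒≤descent u y∈ y∉ in ≤-trans y≤d (≤maxList d∈)

largestDescent-∈ : Unique w → ¬ Increasing w → largestDescent w ∈ descents w
largestDescent-∈ {[]}    _ ¬inc = ⊥-elim (¬inc [])
largestDescent-∈ {_ ∷ _} u ¬inc = maxList-∈ (proj₁ (proj₂ (descent≥head u ¬inc)))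

splitOn-∈ : ∀ w → x ∈ w → splitOn x w ≡ (p , s) → w ≡ p ++ x ∷ s
splitOn-∈ {x} (y ∷ w) x∈ eq with y ≟ x
splitOn-∈ (y ∷ w) _ refl | yes refl = refl
... | no y≢x with splitOn x w in eq′
splitOn-∈ (y ∷ w) (here refl)  refl | no y≢x | _ = ⊥-elim (y≢x refl)
splitOn-∈ (y ∷ w) (there x∈w) refl | no y≢x | _ = cong (y ∷_) (splitOn-∈ w x∈w eq′)

splitOn-descent : ∀ w → d ∈ descents w → splitOn d w ≡ (p , s) → s ≢ []
splitOn-descent {d} (y ∷ w) d∈ eq with y ≟ d
splitOn-descent (y ∷ z ∷ w) _ refl | yes _ = λ ()
... | no y≢d with splitOn d w in eq′
splitOn-descent (y ∷ z ∷ w) d∈ refl | no y≢d | _ =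
  [ (λ (_ , d≡y) → ⊥-elim (y≢d (sym d≡y))) , (λ d∈′ → splitOn-descent (z ∷ w) d∈′ eq′) ]
    (∈-descents-∷∷⁻ y z w d∈)

data RixFinal : List ℕ → Set where
  increasing : Increasing (x ∷ r) → RixFinal (x ∷ r)
  stuck      : ¬ Increasing (x ∷ r) → largestDescent (x ∷ r) ≡ x → RixFinal (x ∷ r)

rixLoop-final : ∀ f w → length w ≤ f → Unique w → w ≢ [] →
                (∃[ p ] w ≡ p ++ rixLoop f w) × RixFinal (rixLoop f w)
rixLoop-final _       []      _     _ w≢[] = ⊥-elim (w≢[] refl)
rixLoop-final (suc f) (y ∷ w) |w|≤f u _ with increasing? (y ∷ w)
... | yes inc = ([] , refl) , increasing inc
... | no ¬inc with splitOn (largestDescent (y ∷ w)) (y ∷ w) in eq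
...   | [] , s = ([] , refl) , stuck ¬inc (sym (∷-injectiveˡ split))
  where
  split : y ∷ w ≡ largestDescent (y ∷ w) ∷ s
  split = splitOn-∈ (y ∷ w) (∈-descents⇒∈ (y ∷ w) (largestDescent-∈ u ¬inc)) eq
...   | c ∷ p , s =
  let (q , s≡) , final = rixLoop-final f s |s|≤f uₛ (splitOn-descent (y ∷ w) m∈ eq)
  in  (c ∷ p ++ m ∷ q , trans split (trans (cong (λ t → c ∷ p ++ m ∷ t) s≡)
                                           (sym (++-assoc (c ∷ p) (m ∷ q) _))))
    , final
  where
  m : ℕ
  m = largestDescent (y ∷ w)
  m∈ : m ∈ descents (y ∷ w)
  m∈ = largestDescent-∈ u ¬inc
  split : y ∷ w ≡ c ∷ p ++ m ∷ s
  split = splitOn-∈ (y ∷ w) (∈-descents⇒∈ (y ∷ w) m∈) eq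
  |s|≤f : length s ≤ f
  |s|≤f = s≤s⁻¹ (≤-trans (length-++-≤ʳ (m ∷ s) {c ∷ p}) (subst ((_≤ suc f) ∘ length) split |w|≤f))
  uₛ : Unique s
  uₛ = AllPairs.tail (Unique-++⁻ʳ (c ∷ p) (subst Unique split u))

all-⇔ : {A B C D : Set} → A → B → C → D → (A ⇔ B) × (B ⇔ C) × (C ⇔ D)
all-⇔ a b c d = mk⇔ (const b) (const a) , mk⇔ (const c) (const b) , mk⇔ (const d) (const c)

none-⇔ : {A B C D : Set} → ¬ A → ¬ B → ¬ C → ¬ D → (A ⇔ B) × (B ⇔ C) × (C ⇔ D)
none-⇔ ¬a ¬b ¬c ¬d =
  mk⇔ (⊥-elim ∘ ¬a) (⊥-elim ∘ ¬b) , mk⇔ (⊥-elim ∘ ¬b) (⊥-elim ∘ ¬c) , mk⇔ (⊥-elim ∘ ¬c) (⊥-elim ∘ ¬d)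

Rixed : List ℕ → ℕ → ℕ → Set
Rixed π b y = y ∈ maxIncSuffix π × b ≤ y

increasing-final-rixed : ∀ p → Increasing (x ∷ r) → y ∈ x ∷ r → Rixed (p ++ x ∷ r) x y
increasing-final-rixed p inc y∈ = ∈-maxIncSuffix-++ p inc y∈ , head≤ inc y∈

stuck-head-not-rixed : ∀ p → Unique (x ∷ r) → ¬ Increasing (x ∷ r) → ¬ Rixed (p ++ x ∷ r) x x
stuck-head-not-rixed p u ¬inc (x∈ , _) =
  head∉maxIncSuffix u ¬inc (subst (_ ∈_) (maxIncSuffix-++ p ¬inc) x∈)

stuck-second<head : Unique (x ∷ z ∷ r) → ¬ Increasing (x ∷ z ∷ r) →
                    largestDescent (x ∷ z ∷ r) ≡ x → z < x
stuck-second<head {x} {z} {r} u ¬inc top =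
  descent-head⁻ u (subst (_∈ descents (x ∷ z ∷ r)) top (largestDescent-∈ u ¬inc))

stuck-not-rixed⇒< : ∀ p → Unique (x ∷ r) → ¬ Increasing (x ∷ r) → largestDescent (x ∷ r) ≡ x →
                    y ∈ x ∷ r → y ≢ x → ¬ Rixed (p ++ x ∷ r) x y → y < x
stuck-not-rixed⇒< {x} {r} {y} p u ¬inc top y∈ y≢x ¬rixed with x ≤? y
... | no x≰y  = ≰⇒> x≰y
... | yes x≤y = ≤∧≢⇒< (subst (y ≤_) top (∉maxIncSuffix⇒≤largestDescent u y∈ y∉)) y≢x
  where
  y∉ : y ∉ maxIncSuffix (x ∷ r)
  y∉ y∈M = ¬rixed (subst (y ∈_) (sym (maxIncSuffix-++ p ¬inc)) y∈M , x≤y)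

rixFinal⇒tfae : ∀ {π} p β → π ≡ p ++ β → Unique π → RixFinal β →
           let R = Rixed π (headOr 0 β) in
           ((Increasing β ⇔ (∀ y → y ∈ β → R y))
            × ((∀ y → y ∈ β → R y) ⇔ (∀ y → y ∈ β → R y ⊎ y ≡ headOr 0 β))
            × ((∀ y → y ∈ β → R y ⊎ y ≡ headOr 0 β) ⇔ R (headOr 0 β)))
           × (∀ y → y ∈ β → y ≢ headOr 0 β → ¬ R y → y < headOr 0 β)
rixFinal⇒tfae p (x ∷ r) refl _ (increasing inc) =
  all-⇔ inc rixed (λ y → inj₁ ∘ rixed y) (rixed x (here refl)) , λ y y∈ _ ¬R → ⊥-elim (¬R (rixed y y∈))
  where
  rixed : ∀ y → y ∈ x ∷ r → Rixed (p ++ x ∷ r) x y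
  rixed _ = increasing-final-rixed p inc
rixFinal⇒tfae p (x ∷ []) refl _ (stuck ¬inc _) = ⊥-elim (¬inc [-])
rixFinal⇒tfae p (x ∷ z ∷ r) refl u (stuck ¬inc top) =
  none-⇔ ¬inc (λ all → ¬c (λ y → inj₁ ∘ all y)) ¬c (stuck-head-not-rixed p uβ ¬inc)
  , λ y → stuck-not-rixed⇒< p uβ ¬inc top
  where
  uβ : Unique (x ∷ z ∷ r)
  uβ = Unique-++⁻ʳ p u
  z<x : z < x
  z<x = stuck-second<head uβ ¬inc top
  ¬c : ¬ (∀ y → y ∈ x ∷ z ∷ r → Rixed (p ++ x ∷ z ∷ r) x y ⊎ y ≡ x)
  ¬c c = [ <⇒≱ z<x ∘ proj₂ , <⇒≢ z<x ] (c z (there (here refl)))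

lemma21 : (n : ℕ) (π : List ℕ) → 1 ≤ n → π ↭ applyUpTo suc n →
            ((Increasing (rixBeta π)
               ⇔ (∀ y → y ∈ rixBeta π → IsRixed π y))
            × ((∀ y → y ∈ rixBeta π → IsRixed π y)
               ⇔ (∀ y → y ∈ rixBeta π → IsRixed π y ⊎ y ≡ beta1 π))
            × ((∀ y → y ∈ rixBeta π → IsRixed π y ⊎ y ≡ beta1 π)
               ⇔ IsRixed π (beta1 π)))
            × (∀ y → y ∈ rixBeta π → y ≢ beta1 π → ¬ IsRixed π y → y < beta1 π)
lemma21 n π 1≤n π↭ =
  let (p , π≡) , final = rixLoop-final (length π) π ≤-refl uπ π≢[]
  in  rixFinal⇒tfae p (rixBeta π) π≡ uπ final
  where
  uπ : Unique π
  uπ = Unique-resp-↭ (↭⇒↭ₛ (↭-sym π↭)) (applyUpTo⁺₁ suc n (λ i<j _ → <⇒≢ i<j ∘ suc-injective))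
  π≢[] : π ≢ []
  π≢[] refl = <⇒≢ 1≤n (trans (↭-length π↭) (length-applyUpTo suc n))
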